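{- Let $T$ be a tournament and $A$ a subset of $V(T)$. If $A$ meets each acyclic component of $T$, then the acyclic components of $T_{\restriction A}$ are the traces $X\cap A$ on $A$ of the acyclic components $X$ of $T$.
   Context: A tournament is a set with an irreflexive, antisymmetric, complete binary relation; acyclic means no $3$-cycle. $T_{\restriction A}$ is the tournament induced on $A$. A subset $B$ of vertices is autonomous if for all $x,x'\in B$ and $y\notin B$, $(x,y)$ is an edge iff $(x',y)$ is an edge. The acyclic component of a vertex $x$ is the union of all acyclic autonomous subsets containing $x$. -}

module Defs where

open import Level using (0ℓ)
open import Data.Product using (Σ; Σ-syntax; ∃; _×_; _,_; proj₁)
open import Data.Sum using (_⊎_)
open import Data.Empty using (⊥)
open import Relation.Nullary using (¬_)
open import Relation.Binary.PropositionalEquality using (_≡_)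
open import Relation.Unary using (Pred; _∈_; _∉_; _⊆_)
open import Function.Bundles using (_⇔_)

record IsTournament {V : Set} (E : V → V → Set) : Set where
  field
    irrefl   : ∀ x → ¬ E x x
    antisym  : ∀ x y → E x y → ¬ E y x
    complete : ∀ x y → ¬ x ≡ y → E x y ⊎ E y x

Subset : Set → Set₁
Subset V = Pred V 0ℓ

module _ {V : Set} (E : V → V → Set) where

  Acyclic : Subset V → Set
  Acyclic B = ∀ x y z → x ∈ B → y ∈ B → z ∈ B →
              E x y → E y z → E z x → ⊥

  Autonomous : Subset V → Set
  Autonomous B = ∀ x x' y → x ∈ B → x' ∈ B → y ∉ B → (E x y ⇔ E x' y)

  AcyclicComponent : V → Pred V (Level.suc 0ℓ)
  AcyclicComponent x v =
    Σ[ B ∈ Subset V ] (Acyclic B × Autonomous B × x ∈ B × v ∈ B)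

Restrict : {V : Set} → (V → V → Set) → (A : Subset V) → Σ V A → Σ V A → Set
Restrict E A p q = E (proj₁ p) (proj₁ q)

Trace : {V : Set} {ℓ : Level.Level} → (A : Subset V) → Pred V ℓ → Pred (Σ V A) ℓ
Trace A X p = X (proj₁ p)

_≐_ : {W : Set} {ℓ₁ ℓ₂ : Level.Level} → Pred W ℓ₁ → Pred W ℓ₂ → Set _
X ≐ Y = (X ⊆ Y) × (Y ⊆ X)

-- Acyclic autonomous sets sharing a point have an acyclic autonomous union,
-- so "lying in a common acyclic autonomous set" is an equivalence relation ~
-- whose classes are the acyclic components; each class is autonomous, hence
-- an edge between two different classes is an edge between any of their
-- representatives.  Restricting an acyclic autonomous set of T to A gives one
-- of T|A.  Conversely, let B be acyclic autonomous in T|A and close it in T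
-- under betweenness (u₁ → w → u₂ with u₁, u₂ in the closure).  The closure is
-- autonomous by construction.  Every vertex w of it is ~ to a vertex of B:
-- otherwise w lies between two classes of B, and the vertex of A in the class
-- of w, which exists since A meets every component, would lie outside B but
-- between two vertices of B, against the autonomy of B.  So a 3-cycle in the
-- closure either has two vertices in one class, impossible inside an acyclic
-- autonomous set, or transfers to a 3-cycle in B.
module Submission where

open import Defs
open import Data.Product using (Σ; Σ-syntax; _×_; _,_; proj₁)
open import Data.Empty using (⊥; ⊥-elim)
open import Data.Sum using (inj₁; inj₂)
open import Function using (_∘_; id)
open import Function.Bundles using (_⇔_; mk⇔; Equivalence)
open import Function.Construct.Composition using (_⇔-∘_)
open import Function.Construct.Symmetry using (⇔-sym)
open import Relation.Nullary using (¬_)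
open import Relation.Binary.PropositionalEquality using (_≢_; refl)
open import Relation.Unary using (_∪_; ｛_｝; _∈_; _∉_)

open Equivalence using (to)

Lift : {V : Set} (A : Subset V) → Subset (Σ V A) → Subset V
Lift A B u = Σ[ u∈A ∈ A u ] B (u , u∈A)

module Components {V : Set} {E : V → V → Set} (T : IsTournament E) where
  open IsTournament T

  E-stable : ∀ {x y} → ¬ ¬ E x y → E x y
  E-stable {x} {y} ¬¬exy with complete x y (λ { refl → ¬¬exy (irrefl x) })
  ... | inj₁ exy = exy
  ... | inj₂ eyx = ⊥-elim (¬¬exy (antisym y x eyx))

  ¬E⇒E : ∀ {x y} → x ≢ y → ¬ E x y → E y x
  ¬E⇒E {x} {y} x≢y ¬exy with complete x y x≢y
  ... | inj₁ exy = ⊥-elim (¬exy exy)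
  ... | inj₂ eyx = eyx

  no-cycle-through-two : ∀ {B x y z} → Acyclic E B → Autonomous E B →
                         x ∈ B → y ∈ B → E x y → E y z → E z x → ⊥
  no-cycle-through-two {B} {x} {y} {z} ac au x∈B y∈B exy eyz ezx = z∈B z∉B
    where
    z∉B : z ∉ B
    z∉B z∈B = ac x y z x∈B y∈B z∈B exy eyz ezx

    z∈B : ¬ z ∉ B
    z∈B z∉B = antisym x z (to (au y x z y∈B x∈B z∉B) eyz) ezx

  ∪-acyclic : ∀ {B₁ B₂} → Acyclic E B₁ → Autonomous E B₁ →
              Acyclic E B₂ → Autonomous E B₂ → Acyclic E (B₁ ∪ B₂)
  ∪-acyclic ac₁ au₁ ac₂ au₂ = λ where
    _ _ _ (inj₁ x∈) (inj₁ y∈) _ exy eyz ezx → no-cycle-through-two ac₁ au₁ x∈ y∈ exy eyz ezx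
    _ _ _ (inj₂ x∈) (inj₂ y∈) _ exy eyz ezx → no-cycle-through-two ac₂ au₂ x∈ y∈ exy eyz ezx
    _ _ _ (inj₁ x∈) (inj₂ _) (inj₁ z∈) exy eyz ezx → no-cycle-through-two ac₁ au₁ z∈ x∈ ezx exy eyz
    _ _ _ (inj₂ x∈) (inj₁ _) (inj₂ z∈) exy eyz ezx → no-cycle-through-two ac₂ au₂ z∈ x∈ ezx exy eyz
    _ _ _ (inj₁ _) (inj₂ y∈) (inj₂ z∈) exy eyz ezx → no-cycle-through-two ac₂ au₂ y∈ z∈ eyz ezx exy
    _ _ _ (inj₂ _) (inj₁ y∈) (inj₁ z∈) exy eyz ezx → no-cycle-through-two ac₁ au₁ y∈ z∈ eyz ezx exy

  ∪-autonomous : ∀ {B₁ B₂ c} → Autonomous E B₁ → Autonomous E B₂ →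
                 c ∈ B₁ → c ∈ B₂ → Autonomous E (B₁ ∪ B₂)
  ∪-autonomous {B₁} {B₂} {c} au₁ au₂ c∈B₁ c∈B₂ x x' y x∈ x'∈ y∉ =
    ⇔-sym (like-c x' x'∈) ⇔-∘ like-c x x∈
    where
    like-c : ∀ u → u ∈ B₁ ∪ B₂ → E u y ⇔ E c y
    like-c u (inj₁ u∈B₁) = au₁ u c y u∈B₁ c∈B₁ (y∉ ∘ inj₁)
    like-c u (inj₂ u∈B₂) = au₂ u c y u∈B₂ c∈B₂ (y∉ ∘ inj₂)

  infix 4 _~_
  _~_ : V → V → Set₁
  _~_ = AcyclicComponent E

  ~-refl : ∀ x → x ~ x
  ~-refl x = ｛ x ｝ , singleton-acyclic , singleton-autonomous , refl , refl
    where
    singleton-acyclic : Acyclic E ｛ x ｝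
    singleton-acyclic _ _ _ refl refl refl exx _ _ = irrefl x exx

    singleton-autonomous : Autonomous E ｛ x ｝
    singleton-autonomous _ _ _ refl refl _ = mk⇔ id id

  ~-sym : ∀ {x y} → x ~ y → y ~ x
  ~-sym (B , ac , au , x∈B , y∈B) = B , ac , au , y∈B , x∈B

  ~-trans : ∀ {x y z} → x ~ y → y ~ z → x ~ z
  ~-trans (B₁ , ac₁ , au₁ , x∈B₁ , y∈B₁) (B₂ , ac₂ , au₂ , y∈B₂ , z∈B₂) =
    B₁ ∪ B₂ , ∪-acyclic ac₁ au₁ ac₂ au₂ , ∪-autonomous au₁ au₂ y∈B₁ y∈B₂ ,
    inj₁ x∈B₁ , inj₂ z∈B₂

  ~-no-cycle : ∀ {x y z} → x ~ y → E x y → E y z → E z x → ⊥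
  ~-no-cycle (B , ac , au , x∈B , y∈B) = no-cycle-through-two ac au x∈B y∈B

  ~-autonomous-out : ∀ {u₁ u₂ w} → u₁ ~ u₂ → ¬ u₁ ~ w → E u₁ w → E u₂ w
  ~-autonomous-out {u₁} {u₂} {w} (B , ac , au , u₁∈B , u₂∈B) u₁≁w =
    to (au u₁ u₂ w u₁∈B u₂∈B (λ w∈B → u₁≁w (B , ac , au , u₁∈B , w∈B)))

  ~-autonomous-in : ∀ {u₁ u₂ w} → u₁ ~ u₂ → ¬ u₁ ~ w → E w u₁ → E w u₂
  ~-autonomous-in {u₁} {u₂} {w} u₁~u₂ u₁≁w ewu₁ = E-stable λ ¬ewu₂ →
    antisym w u₁ ewu₁
      (~-autonomous-out (~-sym u₁~u₂) (u₁≁w ∘ ~-trans u₁~u₂) (¬E⇒E w≢u₂ ¬ewu₂))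
    where
    w≢u₂ : w ≢ u₂
    w≢u₂ refl = u₁≁w u₁~u₂

  cross-edge : ∀ {u u' b b'} → ¬ u ~ u' → u ~ b → u' ~ b' → E u u' → E b b'
  cross-edge u≁u' u~b u'~b' euu' =
    ~-autonomous-in u'~b' (λ u'~b → u≁u' (~-trans u~b (~-sym u'~b)))
      (~-autonomous-out u~b u≁u' euu')

  data Hull (W : Subset V) : Subset V where
    base    : ∀ {u} → W u → Hull W u
    between : ∀ {u₁ u₂ w} → Hull W u₁ → Hull W u₂ → E u₁ w → E w u₂ → Hull W w

  hull-autonomous : ∀ W → Autonomous E (Hull W)
  hull-autonomous W u₁ u₂ w h₁ h₂ w∉ = mk⇔ (transfer h₁ h₂) (transfer h₂ h₁)
    where
    transfer : ∀ {a b} → Hull W a → Hull W b → E a w → E b w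
    transfer ha hb eaw = E-stable λ ¬ebw →
      w∉ (between ha hb eaw (¬E⇒E (λ { refl → w∉ hb }) ¬ebw))

  restriction-acyclic : ∀ {A B} → Acyclic E B → Acyclic (Restrict E A) (B ∘ proj₁)
  restriction-acyclic ac x y z = ac (proj₁ x) (proj₁ y) (proj₁ z)

  restriction-autonomous : ∀ {A B} → Autonomous E B → Autonomous (Restrict E A) (B ∘ proj₁)
  restriction-autonomous au x x' y = au (proj₁ x) (proj₁ x') (proj₁ y)

  ~⇒restricted : ∀ {A a v} {a∈A : A a} {v∈A : A v} → a ~ v →
                 AcyclicComponent (Restrict E A) (a , a∈A) (v , v∈A)
  ~⇒restricted (B , ac , au , a∈B , v∈B) =
    B ∘ proj₁ , restriction-acyclic ac , restriction-autonomous au , a∈B , v∈B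

  module _ {A : Subset V} (meets : ∀ x → Σ[ a ∈ V ] (A a × x ~ a))
           {B : Subset (Σ V A)} (acB : Acyclic (Restrict E A) B)
           (auB : Autonomous (Restrict E A) B) where

    Represented : V → Set₁
    Represented u = Σ[ b ∈ V ] (Lift A B b × u ~ b)

    between-represented : ∀ {u₁ u₂ w} → Represented u₁ → Represented u₂ →
                          E u₁ w → E w u₂ → ¬ ¬ Represented w
    between-represented {u₁} {u₂} {w} (b₁ , (b₁∈A , b₁∈B) , u₁~b₁)
                        (b₂ , (b₂∈A , b₂∈B) , u₂~b₂) eu₁w ewu₂ ¬rep
      with meets w
    ... | a , a∈A , w~a = antisym a b₂ (cross-edge w≁u₂ w~a u₂~b₂ ewu₂) eb₂a
      where
      u₁≁w : ¬ u₁ ~ w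
      u₁≁w u₁~w = ¬rep (b₁ , (b₁∈A , b₁∈B) , ~-trans (~-sym u₁~w) u₁~b₁)

      w≁u₂ : ¬ w ~ u₂
      w≁u₂ w~u₂ = ¬rep (b₂ , (b₂∈A , b₂∈B) , ~-trans w~u₂ u₂~b₂)

      a∉B : (a , a∈A) ∉ B
      a∉B a∈B = ¬rep (a , (a∈A , a∈B) , w~a)

      eb₂a : E b₂ a
      eb₂a = to (auB (b₁ , b₁∈A) (b₂ , b₂∈A) (a , a∈A) b₁∈B b₂∈B a∉B)
                (cross-edge u₁≁w u₁~b₁ w~a eu₁w)

    -- Only up to double negation, which suffices as acyclicity is a negative statement.
    hull-represented : ∀ {u} → Hull (Lift A B) u → ¬ ¬ Represented u
    hull-represented {u} (base u∈) ¬rep = ¬rep (u , u∈ , ~-refl u)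
    hull-represented (between h₁ h₂ eu₁w ewu₂) ¬rep =
      hull-represented h₁ λ rep₁ → hull-represented h₂ λ rep₂ →
      between-represented rep₁ rep₂ eu₁w ewu₂ ¬rep

    represented-no-cycle : ∀ {u₁ u₂ u₃} → Represented u₁ → Represented u₂ → Represented u₃ →
                           E u₁ u₂ → E u₂ u₃ → E u₃ u₁ → ⊥
    represented-no-cycle (b₁ , (b₁∈A , b₁∈B) , u₁~b₁) (b₂ , (b₂∈A , b₂∈B) , u₂~b₂)
                         (b₃ , (b₃∈A , b₃∈B) , u₃~b₃) e₁₂ e₂₃ e₃₁ =
      acB (b₁ , b₁∈A) (b₂ , b₂∈A) (b₃ , b₃∈A) b₁∈B b₂∈B b₃∈B
        (cross-edge (λ c → ~-no-cycle c e₁₂ e₂₃ e₃₁) u₁~b₁ u₂~b₂ e₁₂)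
        (cross-edge (λ c → ~-no-cycle c e₂₃ e₃₁ e₁₂) u₂~b₂ u₃~b₃ e₂₃)
        (cross-edge (λ c → ~-no-cycle c e₃₁ e₁₂ e₂₃) u₃~b₃ u₁~b₁ e₃₁)

    hull-acyclic : Acyclic E (Hull (Lift A B))
    hull-acyclic _ _ _ h₁ h₂ h₃ e₁₂ e₂₃ e₃₁ =
      hull-represented h₁ λ rep₁ → hull-represented h₂ λ rep₂ →
      hull-represented h₃ λ rep₃ → represented-no-cycle rep₁ rep₂ rep₃ e₁₂ e₂₃ e₃₁

    ∈-restricted⇒~ : ∀ {p q} → p ∈ B → q ∈ B → proj₁ p ~ proj₁ q
    ∈-restricted⇒~ {a , a∈A} {v , v∈A} p∈B q∈B =
      Hull (Lift A B) , hull-acyclic , hull-autonomous (Lift A B) ,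
      base (a∈A , p∈B) , base (v∈A , q∈B)

  restricted⇒~ : ∀ {A} → (∀ x → Σ[ a ∈ V ] (A a × x ~ a)) → ∀ {p q} →
                 AcyclicComponent (Restrict E A) p q → proj₁ p ~ proj₁ q
  restricted⇒~ meets (B , ac , au , p∈B , q∈B) = ∈-restricted⇒~ meets ac au p∈B q∈B

open Components using (~-sym; ~-trans; ~⇒restricted; restricted⇒~)

corollary3p11 : {V : Set} (E : V → V → Set) → IsTournament E →
    (A : Subset V) →
    (∀ x → Σ[ a ∈ V ] (A a × AcyclicComponent E x a)) →
    ((p : Σ V A) → Σ[ x ∈ V ]
        (AcyclicComponent (Restrict E A) p ≐ Trace A (AcyclicComponent E x)))
    ×
    ((x : V) → Σ[ p ∈ Σ V A ]
        (Trace A (AcyclicComponent E x) ≐ AcyclicComponent (Restrict E A) p))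
corollary3p11 {V} E T A meets = restricted-is-trace , trace-is-restricted
  where
  restricted-is-trace : (p : Σ V A) → Σ[ x ∈ V ]
    (AcyclicComponent (Restrict E A) p ≐ Trace A (AcyclicComponent E x))
  restricted-is-trace (a , a∈A) = a , restricted⇒~ T meets , ~⇒restricted T

  trace-is-restricted : (x : V) → Σ[ p ∈ Σ V A ]
    (Trace A (AcyclicComponent E x) ≐ AcyclicComponent (Restrict E A) p)
  trace-is-restricted x with meets x
  ... | a , a∈A , x~a =
    (a , a∈A) ,
    (λ x~v → ~⇒restricted T (~-trans T (~-sym T x~a) x~v)) ,
    (λ a~ᴬv → ~-trans T x~a (restricted⇒~ T meets a~ᴬv))
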